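{- Let $M$ be a $k\times k$ matrix with all entries in $\{0,1\}$, $k\ge 1$, such that $\det(M)=\pm1$ and every column of $M$ contains at most two entries equal to $1$. Then $M$ has at least one row containing exactly one entry equal to $1$. -}

module Defs where

open import Data.Bool using (Bool; true; false)
open import Data.Nat using (ℕ; zero; suc)
open import Data.Fin using (Fin; zero; suc; punchIn)
open import Data.Integer using (ℤ; +_; -_; _+_; _*_; 0ℤ; 1ℤ)
open import Data.List using (List; length; filter)
open import Data.List.Base using (allFin)
open import Relation.Binary.PropositionalEquality using (_≡_)
open import Data.Bool.Properties using () renaming (_≟_ to _≟ᵇ_)
open import Relation.Nullary.Decidable using (Dec)

Matrix : ℕ → Set
Matrix k = Fin k → Fin k → ℤ

-- A k×k 0/1-matrix: entry is true ↔ 1, false ↔ 0.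
BinMatrix : ℕ → Set
BinMatrix k = Fin k → Fin k → Bool

⟦_⟧b : Bool → ℤ
⟦ true ⟧b  = 1ℤ
⟦ false ⟧b = 0ℤ

toℤMatrix : ∀ {k} → BinMatrix k → Matrix k
toℤMatrix M i j = ⟦ M i j ⟧b

∑ : ∀ n → (Fin n → ℤ) → ℤ
∑ zero    f = 0ℤ
∑ (suc n) f = f zero + ∑ n (λ j → f (suc j))

sign : ℕ → ℤ
sign zero          = 1ℤ
sign (suc zero)    = - 1ℤ
sign (suc (suc n)) = sign n

minor : ∀ {n} → Matrix (suc n) → Fin (suc n) → Matrix n
minor M j r c = M (suc r) (punchIn j c)

det : ∀ n → Matrix n → ℤ
det zero    M = 1ℤ
det (suc n) M = ∑ (suc n) (λ j → sign (Data.Fin.toℕ j) * M zero j * det n (minor M j))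

colOnes : ∀ {k} → BinMatrix k → Fin k → ℕ
colOnes {k} M j = length (filter (λ i → M i j ≟ᵇ true) (allFin k))

rowOnes : ∀ {k} → BinMatrix k → Fin k → ℕ
rowOnes {k} M i = length (filter (λ j → M i j ≟ᵇ true) (allFin k))

-- Reduce modulo 2. If no row of M contains exactly one 1, then either some row is zero, or
-- every row contains at least two ones; as no column contains more than two, double counting
-- forces every column to contain exactly two, so the rows of M sum to zero over GF(2). In both
-- cases the determinant of M over GF(2) vanishes, i.e. det M is even, which contradicts
-- det M = ±1. Over GF(2) the determinant is the first-row expansion of det with signs dropped;
-- that it vanishes on dependent rows follows from multilinearity once it is known to vanish on
-- a repeated row, which comes from expanding along the first two rows.

module Submission where

open import Algebra.Bundles using (CommutativeMonoid; CommutativeRing)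
import Algebra.Properties.CommutativeSemigroup as CommutativeSemigroupProperties
import Algebra.Properties.CommutativeMonoid.Sum as CommutativeMonoidSum
import Algebra.Properties.Semiring.Sum as SemiringSum
open import Data.Bool using (Bool; true; false; _∧_; _xor_; not; if_then_else_)
open import Data.Bool.Properties
  using (xor-∧-commutativeRing; ∧-distribˡ-xor; ∧-commutativeMonoid; ∧-zeroʳ; xor-same; not-involutive)
  renaming (_≟_ to _≟ᵇ_)
open import Data.Empty using (⊥-elim)
open import Data.Fin using (Fin; zero; suc; punchIn; toℕ; _≟_)
open import Data.Fin.Properties using (any?)
open import Data.Integer as ℤ using (ℤ; +_; _+_; _*_; 0ℤ; 1ℤ; -_)
open import Data.Integer.Properties using (abs-*; +-identityˡ)
open import Data.Integer.Tactic.RingSolver using (solve-∀)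
open import Data.List using (length; filter; tabulate)
open import Data.Nat as ℕ using (ℕ; zero; suc; _≤_; _<_; z≤n; s≤s)
import Data.Nat.Properties as ℕ
open import Data.Product using (∃; _,_)
open import Data.Sum using (_⊎_; inj₁; inj₂)
open import Data.Vec.Functional using (_∷_; tail)
open import Function using (_∘_)
open import Relation.Binary.PropositionalEquality
  using (_≡_; _≢_; _≗_; refl; sym; trans; cong; cong₂; subst; module ≡-Reasoning)
open import Relation.Nullary using (¬_; yes; no)

open import Defs

module ⊕ = SemiringSum (CommutativeRing.semiring xor-∧-commutativeRing)
open ⊕ using () renaming (sum to ⨁)

open CommutativeSemigroupProperties (CommutativeMonoid.commutativeSemigroup ∧-commutativeMonoid)
  using () renaming (x∙yz≈y∙xz to ∧-rotate)

xor-cancelˡ : ∀ a b → a xor (a xor b) ≡ b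
xor-cancelˡ false b = refl
xor-cancelˡ true  b = not-involutive b

xor-cancel-middle : ∀ a x b → (a xor x) xor (x xor b) ≡ a xor b
xor-cancel-middle false false b = refl
xor-cancel-middle false true  b = not-involutive b
xor-cancel-middle true  false b = refl
xor-cancel-middle true  true  b = refl

xor≡false⇒≡ : ∀ {a b} → a xor b ≡ false → a ≡ b
xor≡false⇒≡ {false} {false} _ = refl
xor≡false⇒≡ {true}  {true}  _ = refl

⨁-zero : ∀ {n} {f : Fin n → Bool} → (∀ i → f i ≡ false) → ⨁ f ≡ false
⨁-zero {n} f≡0 = trans (⊕.sum-cong-≗ f≡0) (⊕.sum-replicate-zero n)

⨁-removeAt : ∀ {n} (f : Fin (suc n) → Bool) j → ⨁ (f ∘ punchIn j) ≡ f j xor ⨁ f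
⨁-removeAt f j = begin
  ⨁ (f ∘ punchIn j)                   ≡⟨ xor-cancelˡ (f j) _ ⟨
  f j xor (f j xor ⨁ (f ∘ punchIn j)) ≡⟨ cong (f j xor_) (⊕.sum-remove f) ⟨
  f j xor ⨁ f                         ∎
  where open ≡-Reasoning

-- Off-diagonal terms of a symmetric double sum cancel in pairs.
⨁-symmetric : ∀ {n} (K : Fin n → Fin n → Bool) → (∀ i j → K i j ≡ K j i) →
              ⨁ (λ i → ⨁ (K i)) ≡ ⨁ (λ i → K i i)
⨁-symmetric {zero}  K sym-K = refl
⨁-symmetric {suc n} K sym-K = begin
  (K zero zero xor ⨁ (K zero ∘ suc)) xor ⨁ (λ i → K (suc i) zero xor ⨁ (K (suc i) ∘ suc))
    ≡⟨ cong ((K zero zero xor ⨁ (K zero ∘ suc)) xor_) (⊕.∑-distrib-+ (λ i → K (suc i) zero) _) ⟩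
  (K zero zero xor ⨁ (K zero ∘ suc)) xor (⨁ (λ i → K (suc i) zero) xor ⨁ (λ i → ⨁ (K (suc i) ∘ suc)))
    ≡⟨ cong₂ (λ x y → (K zero zero xor ⨁ (K zero ∘ suc)) xor (x xor y))
             (⊕.sum-cong-≗ (λ i → sym-K (suc i) zero))
             (⨁-symmetric (λ i j → K (suc i) (suc j)) (λ i j → sym-K (suc i) (suc j))) ⟩
  (K zero zero xor ⨁ (K zero ∘ suc)) xor (⨁ (K zero ∘ suc) xor ⨁ (λ i → K (suc i) (suc i)))
    ≡⟨ xor-cancel-middle (K zero zero) _ _ ⟩
  K zero zero xor ⨁ (λ i → K (suc i) (suc i)) ∎
  where open ≡-Reasoning

-- Left inverse of punchIn j, with an arbitrary value at j itself.
punchOut′ : ∀ {n} → Fin (suc (suc n)) → Fin (suc (suc n)) → Fin (suc n)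
punchOut′         zero    zero    = zero
punchOut′         zero    (suc l) = l
punchOut′         (suc j) zero    = zero
punchOut′ {suc n} (suc j) (suc l) = suc (punchOut′ j l)
punchOut′ {zero}  (suc j) (suc l) = zero

punchOut′-punchIn : ∀ {n} (j : Fin (suc (suc n))) c → punchOut′ j (punchIn j c) ≡ c
punchOut′-punchIn         zero    c       = refl
punchOut′-punchIn         (suc j) zero    = refl
punchOut′-punchIn {suc n} (suc j) (suc c) = cong suc (punchOut′-punchIn j c)

punchIn-punchOut′ : ∀ {n} (j l : Fin (suc (suc n))) → l ≢ j → punchIn j (punchOut′ j l) ≡ l
punchIn-punchOut′         zero    zero    l≢j = ⊥-elim (l≢j refl)
punchIn-punchOut′         zero    (suc l) l≢j = refl
punchIn-punchOut′         (suc j) zero    l≢j = refl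
punchIn-punchOut′ {suc n} (suc j) (suc l) l≢j = cong suc (punchIn-punchOut′ j l (l≢j ∘ cong suc))
punchIn-punchOut′ {zero}  (suc zero) (suc zero) l≢j = ⊥-elim (l≢j refl)

-- Deleting j and then c is deleting l = punchIn j c and then the image of j.
punchIn-punchIn : ∀ {n} (j : Fin (suc (suc n))) c (x : Fin n) →
                  punchIn j (punchIn c x) ≡ punchIn (punchIn j c) (punchIn (punchOut′ (punchIn j c) j) x)
punchIn-punchIn         zero    c       x       = refl
punchIn-punchIn         (suc j) zero    x       = refl
punchIn-punchIn {suc n} (suc j) (suc c) zero    = refl
punchIn-punchIn {suc n} (suc j) (suc c) (suc x) = cong suc (punchIn-punchIn j c x)

minorᵇ : ∀ {n} → BinMatrix (suc n) → Fin (suc n) → BinMatrix n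
minorᵇ A j r c = A (suc r) (punchIn j c)

det₂ : ∀ n → BinMatrix n → Bool
det₂ zero    A = true
det₂ (suc n) A = ⨁ (λ j → A zero j ∧ det₂ n (minorᵇ A j))

det₂-cong : ∀ n {A B : BinMatrix n} → (∀ i j → A i j ≡ B i j) → det₂ n A ≡ det₂ n B
det₂-cong zero    A≡B = refl
det₂-cong (suc n) A≡B = ⊕.sum-cong-≗ λ j →
  cong₂ _∧_ (A≡B zero j) (det₂-cong n (λ r c → A≡B (suc r) (punchIn j c)))

det₂-zero-row : ∀ n (A : BinMatrix (suc n)) i → (∀ j → A i j ≡ false) → det₂ (suc n) A ≡ false
det₂-zero-row n       A zero    A₀≡0 = ⨁-zero λ j → cong (_∧ det₂ n (minorᵇ A j)) (A₀≡0 j)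
det₂-zero-row (suc n) A (suc r) Aᵣ≡0 = ⨁-zero λ j →
  trans (cong (A zero j ∧_) (det₂-zero-row n (minorᵇ A j) r (Aᵣ≡0 ∘ punchIn j))) (∧-zeroʳ _)

-- Junk when l ≡ j.
complementaryMinor : ∀ n → (Fin n → Fin (suc (suc n)) → Bool) →
                     Fin (suc (suc n)) → Fin (suc (suc n)) → Bool
complementaryMinor n R j l = det₂ n (λ r c → R r (punchIn j (punchIn (punchOut′ j l) c)))

complementaryMinor-sym : ∀ n R (j l : Fin (suc (suc n))) →
                         complementaryMinor n R j l ≡ complementaryMinor n R l j
complementaryMinor-sym n R j l with l ≟ j
... | yes refl = refl
... | no l≢j = subst (λ l → complementaryMinor n R j l ≡ complementaryMinor n R l j)
                     (punchIn-punchOut′ j l l≢j) (sym-at (punchOut′ j l))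
  where
  sym-at : ∀ c → complementaryMinor n R j (punchIn j c) ≡ complementaryMinor n R (punchIn j c) j
  sym-at c = det₂-cong n λ r x → cong (R r)
    (trans (cong (λ c′ → punchIn j (punchIn c′ x)) (punchOut′-punchIn j c)) (punchIn-punchIn j c x))

-- The first summand cancels the l ≡ j terms of the double sum, which are not in the expansion.
det₂-expand-two-rows : ∀ n a b R → let D = complementaryMinor n R in
  det₂ (suc (suc n)) (a ∷ b ∷ R) ≡
    ⨁ (λ j → a j ∧ (b j ∧ D j j)) xor ⨁ (λ j → ⨁ (λ l → a j ∧ (b l ∧ D j l)))
det₂-expand-two-rows n a b R = begin
  ⨁ (λ j → a j ∧ det₂ (suc n) (minorᵇ (a ∷ b ∷ R) j))
    ≡⟨ ⊕.sum-cong-≗ (λ j → cong (a j ∧_) (second-row j)) ⟩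
  ⨁ (λ j → a j ∧ (g j j xor ⨁ (g j)))
    ≡⟨ ⊕.sum-cong-≗ (λ j → trans (∧-distribˡ-xor (a j) (g j j) (⨁ (g j)))
                                 (cong ((a j ∧ g j j) xor_) (⊕.*-distribˡ-sum (a j) (g j)))) ⟩
  ⨁ (λ j → (a j ∧ g j j) xor ⨁ (λ l → a j ∧ g j l))
    ≡⟨ ⊕.∑-distrib-+ (λ j → a j ∧ g j j) (λ j → ⨁ (λ l → a j ∧ g j l)) ⟩
  ⨁ (λ j → a j ∧ g j j) xor ⨁ (λ j → ⨁ (λ l → a j ∧ g j l)) ∎
  where
  open ≡-Reasoning
  g : Fin (suc (suc n)) → Fin (suc (suc n)) → Bool
  g j l = b l ∧ complementaryMinor n R j l
  second-row : ∀ j → det₂ (suc n) (minorᵇ (a ∷ b ∷ R) j) ≡ g j j xor ⨁ (g j)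
  second-row j = trans (⊕.sum-cong-≗ λ c → cong (λ c′ → b (punchIn j c) ∧ det₂ n (minor-at c′))
                                                (sym (punchOut′-punchIn j c)))
                       (⨁-removeAt (g j) j)
    where
    minor-at : Fin (suc n) → BinMatrix n
    minor-at c r x = R r (punchIn j (punchIn c x))

det₂-equal-first-rows : ∀ n a R → det₂ (suc (suc n)) (a ∷ a ∷ R) ≡ false
det₂-equal-first-rows n a R = begin
  det₂ _ (a ∷ a ∷ R)                           ≡⟨ det₂-expand-two-rows n a a R ⟩
  ⨁ (λ j → K j j) xor ⨁ (λ j → ⨁ (K j))        ≡⟨ cong (⨁ (λ j → K j j) xor_) (⨁-symmetric K K-sym) ⟩
  ⨁ (λ j → K j j) xor ⨁ (λ j → K j j)          ≡⟨ xor-same (⨁ (λ j → K j j)) ⟩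
  false                                        ∎
  where
  open ≡-Reasoning
  K : Fin (suc (suc n)) → Fin (suc (suc n)) → Bool
  K j l = a j ∧ (a l ∧ complementaryMinor n R j l)
  K-sym : ∀ j l → K j l ≡ K l j
  K-sym j l = trans (∧-rotate (a j) (a l) _) (cong (λ d → a l ∧ (a j ∧ d)) (complementaryMinor-sym n R j l))

det₂-swap-first-rows : ∀ n a b R → det₂ (suc (suc n)) (a ∷ b ∷ R) ≡ det₂ (suc (suc n)) (b ∷ a ∷ R)
det₂-swap-first-rows n a b R = begin
  det₂ _ (a ∷ b ∷ R)
    ≡⟨ det₂-expand-two-rows n a b R ⟩
  ⨁ (λ j → a j ∧ (b j ∧ D j j)) xor ⨁ (λ j → ⨁ (λ l → a j ∧ (b l ∧ D j l)))
    ≡⟨ cong₂ _xor_ (⊕.sum-cong-≗ λ j → ∧-rotate (a j) (b j) (D j j))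
                   (⊕.∑-comm (λ j l → a j ∧ (b l ∧ D j l))) ⟩
  ⨁ (λ j → b j ∧ (a j ∧ D j j)) xor ⨁ (λ l → ⨁ (λ j → a j ∧ (b l ∧ D j l)))
    ≡⟨ cong (⨁ (λ j → b j ∧ (a j ∧ D j j)) xor_) (⊕.sum-cong-≗ λ l → ⊕.sum-cong-≗ λ j →
         trans (∧-rotate (a j) (b l) (D j l)) (cong (λ d → b l ∧ (a j ∧ d)) (complementaryMinor-sym n R j l))) ⟩
  ⨁ (λ l → b l ∧ (a l ∧ D l l)) xor ⨁ (λ l → ⨁ (λ j → b l ∧ (a j ∧ D l j)))
    ≡⟨ det₂-expand-two-rows n b a R ⟨
  det₂ _ (b ∷ a ∷ R) ∎
  where
  open ≡-Reasoning
  D = complementaryMinor n R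

-- Induction on the size: swapping the first two rows moves the repeated row into every minor.
det₂-repeated-first-row : ∀ n (A : BinMatrix (suc n)) s → A (suc s) ≗ A zero → det₂ (suc n) A ≡ false
det₂-repeated-first-row (suc n) A zero A₁≡A₀ = begin
  det₂ _ A
    ≡⟨ det₂-cong _ {A = A} {B = A zero ∷ A zero ∷ tail (tail A)}
         (λ { zero _ → refl ; (suc zero) j → A₁≡A₀ j ; (suc (suc r)) _ → refl }) ⟩
  det₂ _ (A zero ∷ A zero ∷ tail (tail A))
    ≡⟨ det₂-equal-first-rows n (A zero) (tail (tail A)) ⟩
  false ∎
  where open ≡-Reasoning
det₂-repeated-first-row (suc (suc n)) A (suc s) Aₛ≡A₀ = begin
  det₂ _ A
    ≡⟨ det₂-cong _ {A = A} {B = A zero ∷ A (suc zero) ∷ rest}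
         (λ { zero _ → refl ; (suc zero) _ → refl ; (suc (suc r)) _ → refl }) ⟩
  det₂ _ (A zero ∷ A (suc zero) ∷ rest)
    ≡⟨ det₂-swap-first-rows (suc n) (A zero) (A (suc zero)) rest ⟩
  det₂ _ swapped
    ≡⟨ ⨁-zero (λ j → trans (cong (A (suc zero) j ∧_) (minor-vanishes j)) (∧-zeroʳ (A (suc zero) j))) ⟩
  false ∎
  where
  open ≡-Reasoning
  rest : Fin (suc n) → Fin (suc (suc (suc n))) → Bool
  rest = tail (tail A)
  swapped : BinMatrix (suc (suc (suc n)))
  swapped = A (suc zero) ∷ A zero ∷ rest
  minor-vanishes : ∀ j → det₂ (suc (suc n)) (minorᵇ swapped j) ≡ false
  minor-vanishes j = det₂-repeated-first-row (suc n) (minorᵇ swapped j) s (Aₛ≡A₀ ∘ punchIn j)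

-- Multilinearity in the first row reduces to matrices with a repeated first row.
det₂-rows-sum-to-zero : ∀ n (A : BinMatrix (suc n)) → (∀ j → ⨁ (λ i → A i j) ≡ false) →
                        det₂ (suc n) A ≡ false
det₂-rows-sum-to-zero n A column-sums-zero = begin
  ⨁ (λ j → A zero j ∧ det₂ n (minorᵇ A j))
    ≡⟨ ⊕.sum-cong-≗ (λ j → cong (_∧ det₂ n (minorᵇ A j)) (xor≡false⇒≡ {A zero j} (column-sums-zero j))) ⟩
  ⨁ (λ j → ⨁ (λ r → A (suc r) j) ∧ det₂ n (minorᵇ A j))
    ≡⟨ ⊕.sum-cong-≗ (λ j → ⊕.*-distribʳ-sum (det₂ n (minorᵇ A j)) (λ r → A (suc r) j)) ⟩
  ⨁ (λ j → ⨁ (λ r → A (suc r) j ∧ det₂ n (minorᵇ A j)))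
    ≡⟨ ⊕.∑-comm (λ j r → A (suc r) j ∧ det₂ n (minorᵇ A j)) ⟩
  ⨁ (λ r → det₂ (suc n) (A (suc r) ∷ tail A))
    ≡⟨ ⨁-zero (λ r → det₂-repeated-first-row n (A (suc r) ∷ tail A) r (λ _ → refl)) ⟩
  false ∎
  where open ≡-Reasoning

infix 4 _≡₂_
_≡₂_ : ℤ → Bool → Set
x ≡₂ b = ∃ λ q → x ≡ ⟦ b ⟧b + (+ 2) * q

⟦⟧b-≡₂ : ∀ b → ⟦ b ⟧b ≡₂ b
⟦⟧b-≡₂ true  = 0ℤ , refl
⟦⟧b-≡₂ false = 0ℤ , refl

sign-≡₂ : ∀ m → sign m ≡₂ true
sign-≡₂ zero          = 0ℤ , refl
sign-≡₂ (suc zero)    = - 1ℤ , refl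
sign-≡₂ (suc (suc m)) = sign-≡₂ m

≡₂-+ : ∀ {x y a b} → x ≡₂ a → y ≡₂ b → x + y ≡₂ a xor b
≡₂-+ {x} {y} {a} {b} (q , x≡) (r , y≡) = ⟦ a ∧ b ⟧b + (q + r) , (begin
  x + y                                              ≡⟨ cong₂ _+_ x≡ y≡ ⟩
  (⟦ a ⟧b + (+ 2) * q) + (⟦ b ⟧b + (+ 2) * r)        ≡⟨ regroup ⟦ a ⟧b ⟦ b ⟧b q r ⟩
  (⟦ a ⟧b + ⟦ b ⟧b) + (+ 2) * (q + r)                ≡⟨ cong (_+ (+ 2) * (q + r)) (carry a b) ⟩
  (⟦ a xor b ⟧b + (+ 2) * ⟦ a ∧ b ⟧b) + (+ 2) * (q + r) ≡⟨ merge ⟦ a xor b ⟧b ⟦ a ∧ b ⟧b (q + r) ⟩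
  ⟦ a xor b ⟧b + (+ 2) * (⟦ a ∧ b ⟧b + (q + r))      ∎)
  where
  open ≡-Reasoning
  regroup : ∀ u v q r → (u + (+ 2) * q) + (v + (+ 2) * r) ≡ (u + v) + (+ 2) * (q + r)
  regroup = solve-∀
  merge : ∀ u c s → (u + (+ 2) * c) + (+ 2) * s ≡ u + (+ 2) * (c + s)
  merge = solve-∀
  carry : ∀ a b → ⟦ a ⟧b + ⟦ b ⟧b ≡ ⟦ a xor b ⟧b + (+ 2) * ⟦ a ∧ b ⟧b
  carry true  true  = refl
  carry true  false = refl
  carry false true  = refl
  carry false false = refl

≡₂-* : ∀ {x y a b} → x ≡₂ a → y ≡₂ b → x * y ≡₂ a ∧ b
≡₂-* {x} {y} {a} {b} (q , x≡) (r , y≡) = s , (begin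
  x * y                                        ≡⟨ cong₂ _*_ x≡ y≡ ⟩
  (⟦ a ⟧b + (+ 2) * q) * (⟦ b ⟧b + (+ 2) * r)  ≡⟨ expand ⟦ a ⟧b ⟦ b ⟧b q r ⟩
  ⟦ a ⟧b * ⟦ b ⟧b + (+ 2) * s                  ≡⟨ cong (_+ (+ 2) * s) (product a b) ⟩
  ⟦ a ∧ b ⟧b + (+ 2) * s                       ∎)
  where
  open ≡-Reasoning
  s = q * ⟦ b ⟧b + ⟦ a ⟧b * r + (+ 2) * q * r
  expand : ∀ u v q r → (u + (+ 2) * q) * (v + (+ 2) * r) ≡ u * v + (+ 2) * (q * v + u * r + (+ 2) * q * r)
  expand = solve-∀
  product : ∀ a b → ⟦ a ⟧b * ⟦ b ⟧b ≡ ⟦ a ∧ b ⟧b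
  product true  true  = refl
  product true  false = refl
  product false true  = refl
  product false false = refl

≡₂-∑ : ∀ n {f : Fin n → ℤ} {g : Fin n → Bool} → (∀ i → f i ≡₂ g i) → ∑ n f ≡₂ ⨁ g
≡₂-∑ zero    f≡g = 0ℤ , refl
≡₂-∑ (suc n) {g = g} f≡g = ≡₂-+ {a = g zero} {b = ⨁ (g ∘ suc)} (f≡g zero) (≡₂-∑ n (f≡g ∘ suc))

det-≡₂-det₂ : ∀ n (M : BinMatrix n) → det n (toℤMatrix M) ≡₂ det₂ n M
det-≡₂-det₂ zero    M = 0ℤ , refl
det-≡₂-det₂ (suc n) M = ≡₂-∑ (suc n) {g = λ j → M zero j ∧ det₂ n (minorᵇ M j)} λ j →
  ≡₂-* {a = M zero j} (≡₂-* {a = true} {b = M zero j} (sign-≡₂ (toℕ j)) (⟦⟧b-≡₂ (M zero j)))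
                      (det-≡₂-det₂ n (minorᵇ M j))

±1-odd : ∀ {x} → x ≡ 1ℤ ⊎ x ≡ - 1ℤ → ¬ (x ≡₂ false)
±1-odd {x} x≡±1 (q , x≡2q) = ℕ.even≢odd ℤ.∣ q ∣ 0 (begin
  2 ℕ.* ℤ.∣ q ∣          ≡⟨ abs-* (+ 2) q ⟨
  ℤ.∣ (+ 2) * q ∣        ≡⟨ cong ℤ.∣_∣ (+-identityˡ ((+ 2) * q)) ⟨
  ℤ.∣ 0ℤ + (+ 2) * q ∣   ≡⟨ cong ℤ.∣_∣ x≡2q ⟨
  ℤ.∣ x ∣                ≡⟨ ∣x∣≡1 x≡±1 ⟩
  1                      ∎)
  where
  open ≡-Reasoning
  ∣x∣≡1 : x ≡ 1ℤ ⊎ x ≡ - 1ℤ → ℤ.∣ x ∣ ≡ 1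
  ∣x∣≡1 (inj₁ refl) = refl
  ∣x∣≡1 (inj₂ refl) = refl

module Σℕ = CommutativeMonoidSum ℕ.+-0-commutativeMonoid
open Σℕ using () renaming (sum to ∑ℕ)

∑ℕ-mono-≤ : ∀ {n} {f g : Fin n → ℕ} → (∀ i → f i ≤ g i) → ∑ℕ f ≤ ∑ℕ g
∑ℕ-mono-≤ {zero}  f≤g = z≤n
∑ℕ-mono-≤ {suc n} f≤g = ℕ.+-mono-≤ (f≤g zero) (∑ℕ-mono-≤ (f≤g ∘ suc))

∑ℕ-mono-< : ∀ {n} {f g : Fin n → ℕ} → (∀ i → f i ≤ g i) → ∀ {j} → f j < g j → ∑ℕ f < ∑ℕ g
∑ℕ-mono-< {suc n} f≤g {zero}  fⱼ<gⱼ = ℕ.+-mono-<-≤ fⱼ<gⱼ (∑ℕ-mono-≤ (f≤g ∘ suc))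
∑ℕ-mono-< {suc n} f≤g {suc j} fⱼ<gⱼ = ℕ.+-mono-≤-< (f≤g zero) (∑ℕ-mono-< (f≤g ∘ suc) fⱼ<gⱼ)

column-sums-saturated : ∀ {n} b (F : Fin n → Fin n → ℕ) → (∀ i → b ≤ ∑ℕ (F i)) →
                        (∀ j → ∑ℕ (λ i → F i j) ≤ b) → ∀ j → ∑ℕ (λ i → F i j) ≡ b
column-sums-saturated {n} b F b≤row col≤b j =
  ℕ.≤-antisym (col≤b j) (ℕ.≮⇒≥ λ colⱼ<b → ℕ.<-irrefl refl (begin-strict
    ∑ℕ (λ j → ∑ℕ (λ i → F i j)) <⟨ ∑ℕ-mono-< col≤b colⱼ<b ⟩
    ∑ℕ {n} (λ _ → b)            ≤⟨ ∑ℕ-mono-≤ b≤row ⟩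
    ∑ℕ (λ i → ∑ℕ (F i))         ≡⟨ Σℕ.∑-comm F ⟩
    ∑ℕ (λ j → ∑ℕ (λ i → F i j)) ∎))
  where open ℕ.≤-Reasoning

count : ∀ {n} → (Fin n → Bool) → ℕ
count f = ∑ℕ (λ i → if f i then 1 else 0)

count-zero : ∀ {n} (f : Fin n → Bool) → count f ≡ 0 → ∀ i → f i ≡ false
count-zero {suc n} f count≡0 i with f zero in f₀≡
count-zero {suc n} f ()      i       | true
count-zero {suc n} f count≡0 zero    | false = f₀≡
count-zero {suc n} f count≡0 (suc i) | false = count-zero (f ∘ suc) count≡0 i

length-filter-tabulate : ∀ {X : Set} n (g : Fin n → X) (P : X → Bool) →
                         length (filter (λ x → P x ≟ᵇ true) (tabulate g)) ≡ count (P ∘ g)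
length-filter-tabulate zero    g P = refl
length-filter-tabulate (suc n) g P with P (g zero)
... | true  = cong suc (length-filter-tabulate n (g ∘ suc) P)
... | false = length-filter-tabulate n (g ∘ suc) P

rowOnes≡count : ∀ {k} (M : BinMatrix k) i → rowOnes M i ≡ count (M i)
rowOnes≡count {k} M i = length-filter-tabulate k (λ j → j) (M i)

colOnes≡count : ∀ {k} (M : BinMatrix k) j → colOnes M j ≡ count (λ i → M i j)
colOnes≡count {k} M j = length-filter-tabulate k (λ i → i) (λ i → M i j)

odd : ℕ → Bool
odd zero    = false
odd (suc m) = not (odd m)

⨁≡odd-count : ∀ {n} (f : Fin n → Bool) → ⨁ f ≡ odd (count f)
⨁≡odd-count {zero}  f = refl
⨁≡odd-count {suc n} f with f zero
... | true  = cong not (⨁≡odd-count (f ∘ suc))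
... | false = ⨁≡odd-count (f ∘ suc)

≢0∧≢1⇒≥2 : ∀ {m} → m ≢ 0 → m ≢ 1 → 2 ≤ m
≢0∧≢1⇒≥2 {zero}        m≢0 m≢1 = ⊥-elim (m≢0 refl)
≢0∧≢1⇒≥2 {suc zero}    m≢0 m≢1 = ⊥-elim (m≢1 refl)
≢0∧≢1⇒≥2 {suc (suc m)} m≢0 m≢1 = s≤s (s≤s z≤n)

det₂-without-unit-rows : ∀ k (M : BinMatrix (suc k)) → (∀ j → colOnes M j ≤ 2) →
                         (∀ i → rowOnes M i ≢ 1) → det₂ (suc k) M ≡ false
det₂-without-unit-rows k M col≤2 row≢1 with any? (λ i → rowOnes M i ℕ.≟ 0)
... | yes (i , rowᵢ≡0) = det₂-zero-row k M i (count-zero (M i) (trans (sym (rowOnes≡count M i)) rowᵢ≡0))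
... | no  no-zero-row  = det₂-rows-sum-to-zero k M λ j →
  trans (⨁≡odd-count (λ i → M i j)) (cong odd (column≡2 j))
  where
  column≡2 : ∀ j → count (λ i → M i j) ≡ 2
  column≡2 = column-sums-saturated 2 (λ i j → if M i j then 1 else 0)
    (λ i → subst (2 ≤_) (rowOnes≡count M i) (≢0∧≢1⇒≥2 (λ rowᵢ≡0 → no-zero-row (i , rowᵢ≡0)) (row≢1 i)))
    (λ j → subst (_≤ 2) (colOnes≡count M j) (col≤2 j))

lemma3 : ∀ (k : ℕ) → 1 ≤ k → (M : BinMatrix k)
         → (det k (toℤMatrix M) ≡ 1ℤ ⊎ det k (toℤMatrix M) ≡ - 1ℤ)
         → (∀ (j : Fin k) → colOnes M j ≤ 2)
         → ∃ λ (i : Fin k) → rowOnes M i ≡ 1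
lemma3 (suc k) _ M det≡±1 col≤2 with any? (λ i → rowOnes M i ℕ.≟ 1)
... | yes unit-row = unit-row
... | no  no-unit-row = ⊥-elim (±1-odd det≡±1 det-even)
  where
  det-even : det (suc k) (toℤMatrix M) ≡₂ false
  det-even = subst (det (suc k) (toℤMatrix M) ≡₂_)
                   (det₂-without-unit-rows k M col≤2 (λ i rowᵢ≡1 → no-unit-row (i , rowᵢ≡1)))
                   (det-≡₂-det₂ (suc k) M)
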